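{- Let $I=(G=(V,E),S,k,d)$ be a yes-instance of \textsc{Gap LS Vertex Cover} and let $\{W_j\}_{j=1}^d$ be a swap family. Then there is a valid $d$-improving $k$-swap $W$ for $S$ in $G$ such that (i) $W$ is connected, or (ii) there is some $W_j$ in the swap family with $j\le d/2$ such that $W_j\subseteq W$ or $W\cap N(W_j)\neq\emptyset$.
   Context: For sets $A,B$, $A\oplus B=(A\setminus B)\cup(B\setminus A)$. For $X\subseteq V$, $N(X)=\bigcup_{v\in X}N(v)\setminus X$. A $k$-swap for a vertex cover $S$ of $G=(V,E)$ is $W\subseteq V$ with $|W|\le k$; it is valid if $S\oplus W$ is a vertex cover; it is $j$-improving if $|W\cap S|-|W\setminus S|\ge j$; it is connected if $G[W]$ is connected. \textsc{Gap LS Vertex Cover}: given $G$, a vertex cover $S$, $k\in\mathbb{N}$ and $d\in[1,k]$, decide whether a valid $d$-improving $k$-swap exists. A swap family is a collection $\{W_j\}_{j=1}^d$ where, for each $j\in[1,d]$, $W_j$ is some minimum-size valid connected $j$-improving $(k-d+j)$-swap for $S$ in $G$, if such a swap exists (otherwise $W_j$ is absent from the family). -}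

module Defs where

open import Data.Nat using (ℕ; zero; suc; _+_; _*_; _∸_; _≤_)
open import Data.Bool using (Bool; true; false)
open import Data.Fin using (Fin)
open import Data.Fin.Subset using (Subset; _∈_; _∉_; _⊆_; _∩_; _∪_; _─_; ∣_∣)
open import Data.Maybe using (Maybe; just; nothing)
open import Data.Product using (Σ; ∃; ∃-syntax; _×_; _,_)
open import Data.Sum using (_⊎_)
open import Relation.Nullary using (¬_)
open import Relation.Binary.PropositionalEquality using (_≡_)

record Graph (n : ℕ) : Set where
  field
    adj    : Fin n → Fin n → Bool
    sym    : ∀ u v → adj u v ≡ adj v u
    irrefl : ∀ u → adj u u ≡ false

module _ {n : ℕ} (G : Graph n) where
  open Graph G

  Edge : Fin n → Fin n → Set
  Edge u v = adj u v ≡ true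

  _⊕_ : Subset n → Subset n → Subset n
  A ⊕ B = (A ─ B) ∪ (B ─ A)

  IsVertexCover : Subset n → Set
  IsVertexCover S = ∀ u v → Edge u v → u ∈ S ⊎ v ∈ S

  _∈N[_] : Fin n → Subset n → Set
  v ∈N[ X ] = v ∉ X × ∃[ u ] (u ∈ X × Edge u v)

  data Reach (W : Subset n) : Fin n → Fin n → Set where
    here : ∀ {u} → u ∈ W → Reach W u u
    step : ∀ {u v w} → u ∈ W → Edge u v → Reach W v w → Reach W u w

  Connected : Subset n → Set
  Connected W = ∀ u v → u ∈ W → v ∈ W → Reach W u v

  IsSwap : ℕ → Subset n → Set
  IsSwap k W = ∣ W ∣ ≤ k

  Valid : Subset n → Subset n → Set
  Valid S W = IsVertexCover (S ⊕ W)

  -- |W ∩ S| - |W ∖ S| ≥ j  (over ℤ), stated in ℕ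
  Improving : Subset n → ℕ → Subset n → Set
  Improving S j W = j + ∣ W ─ S ∣ ≤ ∣ W ∩ S ∣

  GoodSwap : Subset n → ℕ → ℕ → Subset n → Set
  GoodSwap S k j W = IsSwap k W × Valid S W × Improving S j W

  GoodConnSwap : Subset n → ℕ → ℕ → Subset n → Set
  GoodConnSwap S k j W = GoodSwap S k j W × Connected W

  MinConnSwap : Subset n → ℕ → ℕ → Subset n → Set
  MinConnSwap S k j W =
    GoodConnSwap S k j W × (∀ W' → GoodConnSwap S k j W' → ∣ W ∣ ≤ ∣ W' ∣)

  YesInstance : Subset n → ℕ → ℕ → Set
  YesInstance S k d =
    IsVertexCover S × 1 ≤ d × d ≤ k × ∃[ W ] GoodSwap S k d W

  SlotSpec : Subset n → ℕ → ℕ → ℕ → Maybe (Subset n) → Set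
  SlotSpec S k d j (just W) = MinConnSwap S ((k ∸ d) + j) j W
  SlotSpec S k d j nothing  = ¬ (∃[ W ] GoodConnSwap S ((k ∸ d) + j) j W)

  -- a swap family {W_j}_{j=1}^d, given as a function j ↦ W_j (only j ∈ [1,d] matters)
  IsSwapFamily : Subset n → ℕ → ℕ → (ℕ → Maybe (Subset n)) → Set
  IsSwapFamily S k d fam = ∀ j → 1 ≤ j → j ≤ d → SlotSpec S k d j (fam j)

{-# OPTIONS --safe #-}
-- Let W be a minimum-size valid d-improving k-swap; if G[W] is connected we are done.
-- Otherwise call a proper nonempty union of components of G[W] a piece. Pieces are valid,
-- hence (being smaller than W) not d-improving. Let P be a piece of least improvement and
-- Q = W ∖ P. Then Q falls short of d by some j ≥ 1, so P is j-improving, and since P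
-- improves no more than Q, 2j ≤ d. P is connected, as its two halves would be pieces
-- improving at least as much as P, and |P| ≤ k − d + j; so W_j exists and |W_j| ≤ |P|.
-- If W_j ⊄ W and W ∩ N(W_j) = ∅, then W_j is disjoint from W (otherwise W ∩ W_j is a union
-- of components smaller than W_j, and so is a smallest piece C, contradicting minimality of
-- W_j), and Q ∪ W_j is a valid d-improving k-swap containing W_j.
module Submission where

open import Defs
open import Data.Nat using (ℕ; zero; suc; _+_; _*_; _∸_; _≤_; _<_; z≤n; _≤?_; _<?_)
open import Data.Nat.Properties
open import Data.Nat.Induction using (<-wellFounded)
open import Data.Nat.Tactic.RingSolver using (solve-∀)
open import Algebra.Properties.CommutativeSemigroup +-commutativeSemigroup
  using (xy∙z≈xz∙y; xy∙z≈x∙zy; x∙yz≈xz∙y; x∙yz≈yx∙z; x∙yz≈z∙xy)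
open import Induction.WellFounded using (Acc; acc)
open import Data.Bool using (true)
open import Data.Bool.Properties using () renaming (_≟_ to _≟ᵇ_)
open import Data.Fin using (Fin; zero)
open import Data.Fin.Properties using (all?; any?)
open import Data.Fin.Subset
open import Data.Fin.Subset.Properties
open import Data.Vec using ([]; _∷_; here; there; tabulate)
open import Data.Vec.Properties using (lookup∘tabulate; []=⇒lookup; lookup⇒[]=)
open import Data.Maybe using (Maybe; just; nothing)
open import Data.Product using (∃; ∃-syntax; _×_; _,_; proj₁; proj₂; swap)
open import Data.Sum using (_⊎_; inj₁; inj₂; [_,_]) renaming (map to ⊎-map)
open import Data.Empty using (⊥-elim)
open import Function using (_∘_; id; const)
open import Function.Bundles using (_⇔_; mk⇔; Equivalence)
open import Relation.Nullary using (¬_; Dec; yes; no; does)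
open import Relation.Nullary.Decidable using (_×-dec_; _⊎-dec_; _→-dec_; ¬?; map′; dec-true)
open import Relation.Unary using (Decidable)
open import Relation.Binary.PropositionalEquality using (_≡_; refl; sym; trans; cong; subst)

open Equivalence using (to; from)

private
  variable
    n : ℕ
    p q : Subset n
    x : Fin n

x∈p─q⁻ : ∀ (p q : Subset n) → x ∈ p ─ q → x ∈ p × x ∉ q
x∈p─q⁻ (s ∷ p) (inside ∷ q) (there x∈) = let (x∈p , x∉q) = x∈p─q⁻ p q x∈ in there x∈p , x∉q ∘ drop-there
x∈p─q⁻ (s ∷ p) (outside ∷ q) here = here , λ ()
x∈p─q⁻ (s ∷ p) (outside ∷ q) (there x∈) = let (x∈p , x∉q) = x∈p─q⁻ p q x∈ in there x∈p , x∉q ∘ drop-there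

⊆∧⊄⇒⊇ : p ⊆ q → ¬ (p ⊂ q) → q ⊆ p
⊆∧⊄⇒⊇ {p = p} p⊆q p⊄q {x} x∈q with x ∈? p
... | yes x∈p = x∈p
... | no  x∉p = ⊥-elim (p⊄q (p⊆q , x , x∈q , x∉p))

Empty-∩⁺ : (∀ {x} → x ∈ p → x ∉ q) → Empty (p ∩ q)
Empty-∩⁺ {p = p} {q} disjoint (x , x∈p∩q) = let (x∈p , x∈q) = x∈p∩q⁻ p q x∈p∩q in disjoint x∈p x∈q

Empty-∩-mono : ∀ {p′ q′ : Subset n} → p′ ⊆ p → q′ ⊆ q → Empty (p ∩ q) → Empty (p′ ∩ q′)
Empty-∩-mono {p′ = p′} {q′} p′⊆p q′⊆q empty (x , x∈) =
  let (x∈p′ , x∈q′) = x∈p∩q⁻ p′ q′ x∈ in empty (x , x∈p∩q⁺ (p′⊆p x∈p′ , q′⊆q x∈q′))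

∣p∪q∣≡∣p∣+∣q∣ : ∀ (p q : Subset n) → Empty (p ∩ q) → ∣ p ∪ q ∣ ≡ ∣ p ∣ + ∣ q ∣
∣p∪q∣≡∣p∣+∣q∣ []            []            _     = refl
∣p∪q∣≡∣p∣+∣q∣ (inside  ∷ p) (inside  ∷ q) empty = ⊥-elim (empty (zero , here))
∣p∪q∣≡∣p∣+∣q∣ (inside  ∷ p) (outside ∷ q) empty = cong suc (∣p∪q∣≡∣p∣+∣q∣ p q (drop-∷-Empty empty))
∣p∪q∣≡∣p∣+∣q∣ (outside ∷ p) (inside  ∷ q) empty =
  trans (cong suc (∣p∪q∣≡∣p∣+∣q∣ p q (drop-∷-Empty empty))) (sym (+-suc ∣ p ∣ ∣ q ∣))
∣p∪q∣≡∣p∣+∣q∣ (outside ∷ p) (outside ∷ q) empty = ∣p∪q∣≡∣p∣+∣q∣ p q (drop-∷-Empty empty)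

─-distribʳ-∪ : ∀ (r p q : Subset n) → (p ∪ q) ─ r ≡ (p ─ r) ∪ (q ─ r)
─-distribʳ-∪ []            []      []      = refl
─-distribʳ-∪ (inside  ∷ r) (s ∷ p) (t ∷ q) = cong (outside ∷_) (─-distribʳ-∪ r p q)
─-distribʳ-∪ (outside ∷ r) (s ∷ p) (t ∷ q) = cong (_ ∷_) (─-distribʳ-∪ r p q)

p⊆q⇒p∪[q─p]≡q : p ⊆ q → p ∪ (q ─ p) ≡ q
p⊆q⇒p∪[q─p]≡q {p = p} {q} p⊆q = ⊆-antisym ⊆q q⊆
  where
  ⊆q : p ∪ (q ─ p) ⊆ q
  ⊆q x∈ = [ p⊆q , p─q⊆p q p ] (x∈p∪q⁻ p (q ─ p) x∈)
  q⊆ : q ⊆ p ∪ (q ─ p)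
  q⊆ {x} x∈q with x ∈? p
  ... | yes x∈p = p⊆p∪q (q ─ p) x∈p
  ... | no  x∉p = q⊆p∪q p (q ─ p) (x∈p∧x∉q⇒x∈p─q x∈q x∉p)

Empty-p∩[q─p] : ∀ (p q : Subset n) → Empty (p ∩ (q ─ p))
Empty-p∩[q─p] p q = Empty-∩⁺ λ x∈p x∈q─p → proj₂ (x∈p─q⁻ q p x∈q─p) x∈p

⊆-chain-stabilises : (R : ℕ → Subset n) → (∀ t → R t ⊆ R (suc t)) → ∃[ t ] R (suc t) ⊆ R t
⊆-chain-stabilises {n} R R-mono with grows (suc n)
  where
  grows : ∀ t → (∃[ s ] R (suc s) ⊆ R s) ⊎ t ≤ ∣ R t ∣
  grows zero = inj₂ z≤n
  grows (suc t) with grows t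
  ... | inj₁ stable = inj₁ stable
  ... | inj₂ t≤∣Rt∣ with R t ⊂? R (suc t)
  ...   | yes Rt⊂ = inj₂ (≤-<-trans t≤∣Rt∣ (p⊂q⇒∣p∣<∣q∣ Rt⊂))
  ...   | no  Rt⊄ = inj₁ (t , ⊆∧⊄⇒⊇ (R-mono t) Rt⊄)
... | inj₁ stable = stable
... | inj₂ n<∣R∣ = ⊥-elim (<-irrefl refl (≤-trans n<∣R∣ (∣p∣≤n (R (suc n)))))

subset : {P : Fin n → Set} → Decidable P → Subset n
subset P? = tabulate (does ∘ P?)

∈subset⁺ : {P : Fin n → Set} (P? : Decidable P) → P x → x ∈ subset P?
∈subset⁺ {x = x} P? px = lookup⇒[]= x _ (trans (lookup∘tabulate _ x) (dec-true (P? x) px))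

∈subset⁻ : {P : Fin n → Set} (P? : Decidable P) → x ∈ subset P? → P x
∈subset⁻ {x = x} P? x∈ with P? x | trans (sym (lookup∘tabulate (does ∘ P?) x)) ([]=⇒lookup x∈)
... | yes px | _ = px
... | no  _  | ()

argmin : {P : Subset n → Set} → Decidable P → (f : Subset n → ℕ) → ∃ P →
         ∃[ X ] (P X × ∀ Y → P Y → f X ≤ f Y)
argmin {P = P} P? f (X , PX) = descend X PX (<-wellFounded (f X))
  where
  descend : ∀ X → P X → Acc _<_ (f X) → ∃[ X ] (P X × ∀ Y → P Y → f X ≤ f Y)
  descend X PX (acc smaller) with anySubset? (λ Y → P? Y ×-dec f Y <? f X)
  ... | yes (Y , PY , fY<fX) = descend Y PY (smaller fY<fX)
  ... | no  ∄Y               = X , PX , λ Y PY → ≮⇒≥ (λ fY<fX → ∄Y (Y , PY , fY<fX))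

module _ (G : Graph n) where

  edge? : ∀ u v → Dec (Edge G u v)
  edge? u v = Graph.adj G u v ≟ᵇ true

  edge-sym : ∀ {u v} → Edge G u v → Edge G v u
  edge-sym {u} {v} = trans (Graph.sym G v u)

  reach-mono : ∀ {X Y u v} → X ⊆ Y → Reach G X u v → Reach G Y u v
  reach-mono X⊆Y (here u∈X)     = here (X⊆Y u∈X)
  reach-mono X⊆Y (step u∈X e r) = step (X⊆Y u∈X) e (reach-mono X⊆Y r)

  reach-snoc : ∀ {X u v w} → Reach G X u v → Edge G v w → w ∈ X → Reach G X u w
  reach-snoc (here v∈X)      e w∈X = step v∈X e (here w∈X)
  reach-snoc (step u∈X e′ r) e w∈X = step u∈X e′ (reach-snoc r e w∈X)

  -- For X ⊆ Y this says that X is a union of connected components of G[Y].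
  Closed : Subset n → Subset n → Set
  Closed Y X = ∀ {a b} → a ∈ X → b ∈ Y → Edge G a b → b ∈ X

  closed? : ∀ Y X → Dec (Closed Y X)
  closed? Y X = map′ (λ closed {a} {b} → closed a b) (λ closed a b → closed)
    (all? λ a → all? λ b → a ∈? X →-dec (b ∈? Y →-dec (edge? a b →-dec b ∈? X)))

  Piece : Subset n → Subset n → Set
  Piece Y X = Nonempty X × X ⊂ Y × Closed Y X

  piece? : ∀ Y X → Dec (Piece Y X)
  piece? Y X = nonempty? X ×-dec X ⊂? Y ×-dec closed? Y X

  piece⇒⊆ : ∀ {Y X} → Piece Y X → X ⊆ Y
  piece⇒⊆ (_ , X⊂Y , _) = p⊂q⇒p⊆q X⊂Y

  piece-trans : ∀ {W Y X} → Piece W Y → Piece Y X → Piece W X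
  piece-trans (_ , Y⊂W , Y-closed) (X-nonempty , X⊂Y , X-closed) =
    X-nonempty , ⊂-trans X⊂Y Y⊂W ,
    λ a∈X b∈W e → X-closed a∈X (Y-closed (p⊂q⇒p⊆q X⊂Y a∈X) b∈W e) e

  piece-─ : ∀ {Y X} → Piece Y X → Piece Y (Y ─ X)
  piece-─ {Y} {X} ((u , u∈X) , (X⊆Y , v , v∈Y , v∉X) , X-closed) =
    (v , x∈p∧x∉q⇒x∈p─q v∈Y v∉X) , p∩q≢∅⇒p─q⊂p Y X (u , x∈p∩q⁺ (X⊆Y u∈X , u∈X)) , rest-closed
    where
    rest-closed : Closed Y (Y ─ X)
    rest-closed {a} {b} a∈Y─X b∈Y e with b ∈? X
    ... | yes b∈X = ⊥-elim (proj₂ (x∈p─q⁻ Y X a∈Y─X) (X-closed b∈X (proj₁ (x∈p─q⁻ Y X a∈Y─X)) (edge-sym e)))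
    ... | no  b∉X = x∈p∧x∉q⇒x∈p─q b∈Y b∉X

  ∩-closed : ∀ {Y X} → Closed Y X → Closed Y (Y ∩ X)
  ∩-closed {Y} {X} X-closed a∈Y∩X b∈Y e = x∈p∩q⁺ (b∈Y , X-closed (proj₂ (x∈p∩q⁻ Y X a∈Y∩X)) b∈Y e)

  private
    module Ball (Y : Subset n) {u} (u∈Y : u ∈ Y) where
      ball : ℕ → Subset n
      next? : ∀ t b → Dec (b ∈ Y × ∃[ a ] (a ∈ ball t × Edge G a b))

      ball zero    = ⁅ u ⁆
      ball (suc t) = ball t ∪ subset (next? t)

      next? t b = b ∈? Y ×-dec any? λ a → a ∈? ball t ×-dec edge? a b

      ball⊆Y : ∀ t → ball t ⊆ Y
      ball⊆Y zero    v∈ with x∈⁅y⁆⇒x≡y u v∈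
      ... | refl = u∈Y
      ball⊆Y (suc t) v∈ = [ ball⊆Y t , proj₁ ∘ ∈subset⁻ (next? t) ] (x∈p∪q⁻ (ball t) _ v∈)

      u∈ball : ∀ t → u ∈ ball t
      u∈ball zero    = x∈⁅x⁆ u
      u∈ball (suc t) = p⊆p∪q _ (u∈ball t)

      reach : ∀ t {v} → v ∈ ball t → Reach G (ball t) u v
      reach zero v∈ with x∈⁅y⁆⇒x≡y u v∈
      ... | refl = here v∈
      reach (suc t) v∈ with x∈p∪q⁻ (ball t) _ v∈
      ... | inj₁ v∈ball = reach-mono (p⊆p∪q _) (reach t v∈ball)
      ... | inj₂ v∈new  = let (_ , a , a∈ball , e) = ∈subset⁻ (next? t) v∈new in
        reach-snoc (reach-mono (p⊆p∪q _) (reach t a∈ball)) e v∈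

      stable⇒closed : ∀ t → ball (suc t) ⊆ ball t → Closed Y (ball t)
      stable⇒closed t stable a∈ b∈Y e = stable (q⊆p∪q (ball t) _ (∈subset⁺ (next? t) (b∈Y , _ , a∈ , e)))

  component : ∀ Y {u} → u ∈ Y →
              ∃[ K ] (K ⊆ Y × u ∈ K × Closed Y K × ∀ {v} → v ∈ K → Reach G K u v)
  component Y u∈Y =
    let (t , stable) = ⊆-chain-stabilises ball (λ t → p⊆p∪q _)
    in ball t , ball⊆Y t , u∈ball t , stable⇒closed t stable , reach t
    where open Ball Y u∈Y

  no-piece⇒connected : ∀ {Y} → ¬ ∃ (Piece Y) → Connected G Y
  no-piece⇒connected {Y} ∄piece u v u∈Y v∈Y with component Y u∈Y
  ... | K , K⊆Y , u∈K , K-closed , reach with K ⊂? Y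
  ...   | yes K⊂Y = ⊥-elim (∄piece (K , (u , u∈K) , K⊂Y , K-closed))
  ...   | no  K⊄Y = reach-mono K⊆Y (reach (⊆∧⊄⇒⊇ K⊆Y K⊄Y v∈Y))

  connected-or-piece : ∀ Y → Connected G Y ⊎ ∃ (Piece Y)
  connected-or-piece Y with anySubset? (piece? Y)
  ... | yes piece = inj₂ piece
  ... | no  ∄piece = inj₁ (no-piece⇒connected ∄piece)

  MeetsN : Subset n → Subset n → Set
  MeetsN Y X = ∃[ v ] (v ∈ Y × _∈N[_] G v X)

  meetsN? : ∀ Y X → Dec (MeetsN Y X)
  meetsN? Y X = any? λ v → v ∈? Y ×-dec ¬? (v ∈? X) ×-dec any? λ u → u ∈? X ×-dec edge? u v

  ¬meetsN⇒closed : ∀ {Y X} → ¬ MeetsN Y X → Closed Y X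
  ¬meetsN⇒closed {X = X} ∄v {a} {b} a∈X b∈Y e with b ∈? X
  ... | yes b∈X = b∈X
  ... | no  b∉X = ⊥-elim (∄v (b , b∈Y , b∉X , a , a∈X , e))

module _ (G : Graph n) (S : Subset n) where

  ⊕-resp-⇔ : ∀ {X Z x} → (x ∈ X ⇔ x ∈ Z) → x ∈ _⊕_ G S X → x ∈ _⊕_ G S Z
  ⊕-resp-⇔ {X} {Z} x∈X⇔x∈Z x∈S⊕X with x∈p∪q⁻ (S ─ X) (X ─ S) x∈S⊕X
  ... | inj₁ x∈S─X = let (x∈S , x∉X) = x∈p─q⁻ S X x∈S─X in
    p⊆p∪q (Z ─ S) (x∈p∧x∉q⇒x∈p─q x∈S (x∉X ∘ from x∈X⇔x∈Z))
  ... | inj₂ x∈X─S = let (x∈X , x∉S) = x∈p─q⁻ X S x∈X─S in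
    q⊆p∪q (S ─ Z) (Z ─ S) (x∈p∧x∉q⇒x∈p─q (to x∈X⇔x∈Z x∈X) x∉S)

  valid-local : ∀ {Z} → (∀ {u v} → Edge G u v → ∃[ X ] (Valid G S X × (u ∈ X ⇔ u ∈ Z) × (v ∈ X ⇔ v ∈ Z))) →
                Valid G S Z
  valid-local agree u v e =
    let (X , X-valid , u⇔ , v⇔) = agree e in ⊎-map (⊕-resp-⇔ u⇔) (⊕-resp-⇔ v⇔) (X-valid u v e)

  valid-⊥ : IsVertexCover G S → Valid G S ⊥
  valid-⊥ S-cover u v e = ⊎-map S⊆S⊕⊥ S⊆S⊕⊥ (S-cover u v e)
    where
    S⊆S⊕⊥ : S ⊆ _⊕_ G S ⊥
    S⊆S⊕⊥ x∈S = p⊆p∪q (⊥ ─ S) (x∈p∧x∉q⇒x∈p─q x∈S ∉⊥)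

  valid? : ∀ X → Dec (Valid G S X)
  valid? X = all? λ u → all? λ v → edge? G u v →-dec (u ∈? _⊕_ G S X ⊎-dec v ∈? _⊕_ G S X)

  valid-closed : ∀ {W X} → IsVertexCover G S → Valid G S W → X ⊆ W → Closed G W X → Valid G S X
  valid-closed {W} {X} S-cover W-valid X⊆W X-closed = valid-local agree
    where
    agree-W : ∀ {u v} → u ∈ X → Edge G u v → (u ∈ W ⇔ u ∈ X) × (v ∈ W ⇔ v ∈ X)
    agree-W u∈X e = mk⇔ (const u∈X) X⊆W , mk⇔ (λ v∈W → X-closed u∈X v∈W e) X⊆W

    agree-⊥ : ∀ {x} → x ∉ X → x ∈ ⊥ ⇔ x ∈ X
    agree-⊥ x∉X = mk⇔ (⊥-elim ∘ ∉⊥) (⊥-elim ∘ x∉X)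

    agree : ∀ {u v} → Edge G u v → ∃[ Y ] (Valid G S Y × (u ∈ Y ⇔ u ∈ X) × (v ∈ Y ⇔ v ∈ X))
    agree {u} {v} e with u ∈? X | v ∈? X
    ... | yes u∈X | _       = W , W-valid , agree-W u∈X e
    ... | no  _   | yes v∈X = W , W-valid , swap (agree-W v∈X (edge-sym G e))
    ... | no  u∉X | no  v∉X = ⊥ , valid-⊥ S-cover , agree-⊥ u∉X , agree-⊥ v∉X

  valid-∪ : ∀ {X Y} → Valid G S X → Valid G S Y → (∀ {a b} → a ∈ X → b ∈ Y → ¬ Edge G a b) →
            Valid G S (X ∪ Y)
  valid-∪ {X} {Y} X-valid Y-valid no-edge = valid-local agree
    where
    agree-Y : ∀ {u v} → u ∈ Y → Edge G u v → (u ∈ Y ⇔ u ∈ X ∪ Y) × (v ∈ Y ⇔ v ∈ X ∪ Y)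
    agree-Y u∈Y e =
      mk⇔ (q⊆p∪q X Y) (const u∈Y) ,
      mk⇔ (q⊆p∪q X Y) (λ v∈X∪Y → [ (λ v∈X → ⊥-elim (no-edge v∈X u∈Y (edge-sym G e))) , id ] (x∈p∪q⁻ X Y v∈X∪Y))

    agree-X : ∀ {x} → x ∉ Y → x ∈ X ⇔ x ∈ X ∪ Y
    agree-X x∉Y = mk⇔ (p⊆p∪q Y) (λ x∈X∪Y → [ id , ⊥-elim ∘ x∉Y ] (x∈p∪q⁻ X Y x∈X∪Y))

    agree : ∀ {u v} → Edge G u v → ∃[ Z ] (Valid G S Z × (u ∈ Z ⇔ u ∈ X ∪ Y) × (v ∈ Z ⇔ v ∈ X ∪ Y))
    agree {u} {v} e with u ∈? Y | v ∈? Y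
    ... | yes u∈Y | _       = Y , Y-valid , agree-Y u∈Y e
    ... | no  _   | yes v∈Y = Y , Y-valid , swap (agree-Y v∈Y (edge-sym G e))
    ... | no  u∉Y | no  v∉Y = X , X-valid , agree-X u∉Y , agree-X v∉Y

  goodSwap? : ∀ k d X → Dec (GoodSwap G S k d X)
  goodSwap? k d X = ∣ X ∣ ≤? k ×-dec valid? X ×-dec d + ∣ X ─ S ∣ ≤? ∣ X ∩ S ∣

  gain loss : Subset n → ℕ
  gain X = ∣ X ∩ S ∣
  loss X = ∣ X ─ S ∣

  -- X improves S by at most as much as Y: |X ∩ S| − |X ∖ S| ≤ |Y ∩ S| − |Y ∖ S|.
  _≼_ : Subset n → Subset n → Set
  X ≼ Y = gain X + loss Y ≤ gain Y + loss X

  -- |X ∩ S| − |X ∖ S| = d − j: the swap X falls short of being d-improving by exactly j.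
  Deficit : ℕ → ℕ → Subset n → Set
  Deficit d j X = j + gain X ≡ d + loss X

  -- The number of vertices on which X and S agree, i.e. n − |S ⊕ X|; it orders swaps like _≼_.
  agreement : Subset n → ℕ
  agreement X = gain X + loss (∁ X)

  gain-∪ : ∀ {X Y} → Empty (X ∩ Y) → gain (X ∪ Y) ≡ gain X + gain Y
  gain-∪ {X} {Y} disjoint = trans (cong ∣_∣ (∩-distribʳ-∪ S X Y))
    (∣p∪q∣≡∣p∣+∣q∣ (X ∩ S) (Y ∩ S) (Empty-∩-mono (p∩q⊆p X S) (p∩q⊆p Y S) disjoint))

  loss-∪ : ∀ {X Y} → Empty (X ∩ Y) → loss (X ∪ Y) ≡ loss X + loss Y
  loss-∪ {X} {Y} disjoint = trans (cong ∣_∣ (─-distribʳ-∪ S X Y))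
    (∣p∪q∣≡∣p∣+∣q∣ (X ─ S) (Y ─ S) (Empty-∩-mono (p─q⊆p X S) (p─q⊆p Y S) disjoint))

  ¬improving⇒deficit : ∀ {d X} → ¬ Improving G S d X → ∃[ j ] (1 ≤ j × Deficit d j X)
  ¬improving⇒deficit {d} {X} ¬improving =
    d + loss X ∸ gain X , m<n⇒0<n∸m short , m∸n+n≡m (<⇒≤ short)
    where short = ≰⇒> ¬improving

  improving-≼ : ∀ {j X Y} → Improving G S j X → X ≼ Y → Improving G S j Y
  improving-≼ {j} {X} {Y} X-improving X≼Y = +-cancelʳ-≤ (loss X) (j + loss Y) (gain Y) (begin
    j + loss Y + loss X ≡⟨ xy∙z≈xz∙y j (loss Y) (loss X) ⟩
    j + loss X + loss Y ≤⟨ +-monoˡ-≤ (loss Y) X-improving ⟩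
    gain X + loss Y     ≤⟨ X≼Y ⟩
    gain Y + loss X     ∎)
    where open ≤-Reasoning

  improving-∪⁻ : ∀ {d j X Y} → Empty (X ∩ Y) → Improving G S d (X ∪ Y) → Deficit d j Y → Improving G S j X
  improving-∪⁻ {d} {j} {X} {Y} disjoint XY-improving Y-deficit =
    +-cancelʳ-≤ (gain Y) (j + loss X) (gain X) (begin
      j + loss X + gain Y   ≡⟨ xy∙z≈xz∙y j (loss X) (gain Y) ⟩
      j + gain Y + loss X   ≡⟨ cong (_+ loss X) Y-deficit ⟩
      d + loss Y + loss X   ≡⟨ xy∙z≈x∙zy d (loss Y) (loss X) ⟩
      d + (loss X + loss Y) ≡⟨ cong (d +_) (loss-∪ disjoint) ⟨
      d + loss (X ∪ Y)      ≤⟨ XY-improving ⟩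
      gain (X ∪ Y)          ≡⟨ gain-∪ disjoint ⟩
      gain X + gain Y       ∎)
    where open ≤-Reasoning

  improving-∪⁺ : ∀ {d j X Y} → Empty (X ∩ Y) → Improving G S j X → Deficit d j Y → Improving G S d (X ∪ Y)
  improving-∪⁺ {d} {j} {X} {Y} disjoint X-improving Y-deficit = begin
    d + loss (X ∪ Y)      ≡⟨ cong (d +_) (loss-∪ disjoint) ⟩
    d + (loss X + loss Y) ≡⟨ x∙yz≈xz∙y d (loss X) (loss Y) ⟩
    d + loss Y + loss X   ≡⟨ cong (_+ loss X) Y-deficit ⟨
    j + gain Y + loss X   ≡⟨ xy∙z≈xz∙y j (gain Y) (loss X) ⟩
    j + loss X + gain Y   ≤⟨ +-monoˡ-≤ (gain Y) X-improving ⟩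
    gain X + gain Y       ≡⟨ gain-∪ disjoint ⟨
    gain (X ∪ Y)          ∎
    where open ≤-Reasoning

  improving∧deficit⇒2*j≤d : ∀ {d j X} → Improving G S j X → Deficit d j X → 2 * j ≤ d
  improving∧deficit⇒2*j≤d {d} {j} {X} X-improving X-deficit =
    +-cancelʳ-≤ (loss X) (2 * j) d (begin
      2 * j + loss X   ≡⟨ cong (λ m → j + m + loss X) (+-identityʳ j) ⟩
      j + j + loss X   ≡⟨ +-assoc j j (loss X) ⟩
      j + (j + loss X) ≤⟨ +-monoʳ-≤ j X-improving ⟩
      j + gain X       ≡⟨ X-deficit ⟩
      d + loss X       ∎)
    where open ≤-Reasoning

  ≼-part⇒gain≤loss : ∀ {X Y} → Empty (X ∩ Y) → (X ∪ Y) ≼ X → gain Y ≤ loss Y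
  ≼-part⇒gain≤loss {X} {Y} disjoint XY≼X =
    +-cancelʳ-≤ (gain X + loss X) (gain Y) (loss Y) (begin
      gain Y + (gain X + loss X) ≡⟨ x∙yz≈yx∙z (gain Y) (gain X) (loss X) ⟩
      gain X + gain Y + loss X   ≡⟨ cong (_+ loss X) (gain-∪ disjoint) ⟨
      gain (X ∪ Y) + loss X      ≤⟨ XY≼X ⟩
      gain X + loss (X ∪ Y)      ≡⟨ cong (gain X +_) (loss-∪ disjoint) ⟩
      gain X + (loss X + loss Y) ≡⟨ x∙yz≈z∙xy (gain X) (loss X) (loss Y) ⟩
      loss Y + (gain X + loss X) ∎)
    where open ≤-Reasoning

  ¬improving-split : ∀ {X Y} → Empty (X ∩ Y) → (X ∪ Y) ≼ X → (X ∪ Y) ≼ Y → ¬ Improving G S 1 (X ∪ Y)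
  ¬improving-split {X} {Y} disjoint XY≼X XY≼Y XY-improving = <⇒≱ XY-improving (begin
    gain (X ∪ Y)    ≡⟨ gain-∪ disjoint ⟩
    gain X + gain Y ≤⟨ +-mono-≤ X-gain≤loss (≼-part⇒gain≤loss disjoint XY≼X) ⟩
    loss X + loss Y ≡⟨ loss-∪ disjoint ⟨
    loss (X ∪ Y)    ∎)
    where
    open ≤-Reasoning
    X-gain≤loss : gain X ≤ loss X
    X-gain≤loss = ≼-part⇒gain≤loss (subst Empty (∩-comm X Y) disjoint) (subst (_≼ Y) (∪-comm X Y) XY≼Y)

  agreement-≤⇒≼ : ∀ {X Y} → agreement X ≤ agreement Y → X ≼ Y
  agreement-≤⇒≼ {X} {Y} agreeX≤agreeY = +-cancelʳ-≤ (loss ⊤) (gain X + loss Y) (gain Y + loss X) (begin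
    gain X + loss Y + loss ⊤                ≡⟨ cong (gain X + loss Y +_) (loss+loss∁ X) ⟨
    gain X + loss Y + (loss X + loss (∁ X)) ≡⟨ rearrange (gain X) (loss Y) (loss X) (loss (∁ X)) ⟩
    agreement X + (loss Y + loss X)         ≤⟨ +-monoˡ-≤ (loss Y + loss X) agreeX≤agreeY ⟩
    agreement Y + (loss Y + loss X)         ≡⟨ rearrange′ (gain Y) (loss (∁ Y)) (loss Y) (loss X) ⟩
    gain Y + loss X + (loss Y + loss (∁ Y)) ≡⟨ cong (gain Y + loss X +_) (loss+loss∁ Y) ⟩
    gain Y + loss X + loss ⊤                ∎)
    where
    open ≤-Reasoning
    loss+loss∁ : ∀ X → loss X + loss (∁ X) ≡ loss ⊤
    loss+loss∁ X = trans (sym (loss-∪ {X} {∁ X} (Empty-∩⁺ x∈p⇒x∉∁p))) (cong loss (p∪∁p≡⊤ X))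
    rearrange : ∀ a b c d → a + b + (c + d) ≡ a + d + (b + c)
    rearrange = solve-∀
    rearrange′ : ∀ a b c d → a + b + (c + d) ≡ a + d + (c + b)
    rearrange′ = solve-∀

  ∣p∣≤k∸d+j : ∀ {k d j} {P Q : Subset n} → ∣ P ∣ + ∣ Q ∣ ≤ k → d ≤ k → Deficit d j Q → ∣ P ∣ ≤ k ∸ d + j
  ∣p∣≤k∸d+j {k} {d} {j} {P} {Q} PQ≤k d≤k Q-deficit = +-cancelʳ-≤ (gain Q) ∣ P ∣ (k ∸ d + j) (begin
    ∣ P ∣ + gain Q       ≤⟨ +-monoʳ-≤ ∣ P ∣ (∣p∩q∣≤∣p∣ Q S) ⟩
    ∣ P ∣ + ∣ Q ∣        ≤⟨ PQ≤k ⟩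
    k                    ≤⟨ m≤m+n k (loss Q) ⟩
    k + loss Q           ≡⟨ cong (_+ loss Q) (m∸n+n≡m d≤k) ⟨
    k ∸ d + d + loss Q   ≡⟨ +-assoc (k ∸ d) d (loss Q) ⟩
    k ∸ d + (d + loss Q) ≡⟨ cong (k ∸ d +_) Q-deficit ⟨
    k ∸ d + (j + gain Q) ≡⟨ +-assoc (k ∸ d) j (gain Q) ⟨
    k ∸ d + j + gain Q   ∎)
    where open ≤-Reasoning

  MeetsFamily : ℕ → (ℕ → Maybe (Subset n)) → Subset n → Set
  MeetsFamily d fam W′ =
    ∃[ j ] ∃[ Wj ] (1 ≤ j × 2 * j ≤ d × fam j ≡ just Wj × (Wj ⊆ W′ ⊎ MeetsN G W′ Wj))

  module Disconnected
    (S-cover : IsVertexCover G S) {k d} (d≤k : d ≤ k)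
    (fam : ℕ → Maybe (Subset n)) (family : IsSwapFamily G S k d fam)
    {W} (W-good : GoodSwap G S k d W) (W-min : ∀ Y → GoodSwap G S k d Y → ∣ W ∣ ≤ ∣ Y ∣)
    {P} (P-piece : Piece G W P) (P-min : ∀ Y → Piece G W Y → agreement P ≤ agreement Y)
    {C} (C-piece : Piece G W C) (C-min : ∀ Y → Piece G W Y → ∣ C ∣ ≤ ∣ Y ∣)
    where

    W-valid : Valid G S W
    W-valid = proj₁ (proj₂ W-good)

    W-improving : Improving G S d W
    W-improving = proj₂ (proj₂ W-good)

    piece-valid : ∀ {X} → Piece G W X → Valid G S X
    piece-valid X-piece@(_ , _ , X-closed) = valid-closed S-cover W-valid (piece⇒⊆ G X-piece) X-closed

    piece-¬improving : ∀ {X} → Piece G W X → ¬ Improving G S d X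
    piece-¬improving X-piece@(_ , X⊂W , _) X-improving =
      <⇒≱ ∣X∣<∣W∣ (W-min _ (≤-trans (<⇒≤ ∣X∣<∣W∣) (proj₁ W-good) , piece-valid X-piece , X-improving))
      where ∣X∣<∣W∣ = p⊂q⇒∣p∣<∣q∣ X⊂W

    P≼ : ∀ {Y} → Piece G W Y → P ≼ Y
    P≼ {Y} Y-piece = agreement-≤⇒≼ {P} {Y} (P-min Y Y-piece)

    Q : Subset n
    Q = W ─ P

    Q-piece : Piece G W Q
    Q-piece = piece-─ G P-piece

    P∪Q≡W : P ∪ Q ≡ W
    P∪Q≡W = p⊆q⇒p∪[q─p]≡q (piece⇒⊆ G P-piece)

    ∣P∣+∣Q∣≤k : ∣ P ∣ + ∣ Q ∣ ≤ k
    ∣P∣+∣Q∣≤k = subst (_≤ k) (trans (cong ∣_∣ (sym P∪Q≡W)) (∣p∪q∣≡∣p∣+∣q∣ P Q (Empty-p∩[q─p] P W))) (proj₁ W-good)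

    private
      Q-deficit-exists : ∃[ j ] (1 ≤ j × Deficit d j Q)
      Q-deficit-exists = ¬improving⇒deficit {X = Q} (piece-¬improving Q-piece)

    j : ℕ
    j = proj₁ Q-deficit-exists

    1≤j : 1 ≤ j
    1≤j = proj₁ (proj₂ Q-deficit-exists)

    Q-deficit : Deficit d j Q
    Q-deficit = proj₂ (proj₂ Q-deficit-exists)

    P-improving : Improving G S j P
    P-improving = improving-∪⁻ {X = P} {Q} (Empty-p∩[q─p] P W) (subst (Improving G S d) (sym P∪Q≡W) W-improving) Q-deficit

    2*j≤d : 2 * j ≤ d
    2*j≤d = improving∧deficit⇒2*j≤d {X = Q} (improving-≼ {X = P} {Q} P-improving (P≼ Q-piece)) Q-deficit

    j≤d : j ≤ d
    j≤d = ≤-trans (m≤m+n j (j + 0)) 2*j≤d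

    P-connected : Connected G P
    P-connected = no-piece⇒connected G ∄piece
      where
      ∄piece : ¬ ∃ (Piece G P)
      ∄piece (K , K-piece) =
        ¬improving-split (Empty-p∩[q─p] K P)
          (subst (_≼ K) (sym K∪R≡P) (P≼ (piece-trans G P-piece K-piece)))
          (subst (_≼ (P ─ K)) (sym K∪R≡P) (P≼ (piece-trans G P-piece (piece-─ G K-piece))))
          (subst (Improving G S 1) (sym K∪R≡P) (≤-trans (+-monoˡ-≤ (loss P) 1≤j) P-improving))
        where K∪R≡P = p⊆q⇒p∪[q─p]≡q (piece⇒⊆ G K-piece)

    P-swap : GoodConnSwap G S (k ∸ d + j) j P
    P-swap = (∣p∣≤k∸d+j {P = P} {Q} ∣P∣+∣Q∣≤k d≤k Q-deficit , piece-valid P-piece , P-improving) , P-connected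

    C-swap : GoodConnSwap G S (k ∸ d + j) j C
    C-swap = (≤-trans (C-min P P-piece) (proj₁ (proj₁ P-swap)) , piece-valid C-piece ,
              improving-≼ {X = P} {C} P-improving (P≼ C-piece)) , no-piece⇒connected G ∄piece
      where
      ∄piece : ¬ ∃ (Piece G C)
      ∄piece (K , K-piece@(_ , K⊂C , _)) = <⇒≱ (p⊂q⇒∣p∣<∣q∣ K⊂C) (C-min K (piece-trans G C-piece K-piece))

    ∣C∣≤closed : ∀ {A} → A ⊆ W → Nonempty A → Closed G W A → ∣ C ∣ ≤ ∣ A ∣
    ∣C∣≤closed {A} A⊆W A-nonempty A-closed with A ⊂? W
    ... | yes A⊂W = C-min A (A-nonempty , A⊂W , A-closed)
    ... | no  A⊄W = ≤-trans (p⊆q⇒∣p∣≤∣q∣ (piece⇒⊆ G C-piece)) (p⊆q⇒∣p∣≤∣q∣ (⊆∧⊄⇒⊇ A⊆W A⊄W))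

    J∪Q-good : ∀ {J} → GoodSwap G S (k ∸ d + j) j J → ∣ J ∣ ≤ ∣ P ∣ → Closed G W J → Empty (W ∩ J) →
               GoodSwap G S k d (J ∪ Q)
    J∪Q-good {J} (_ , J-valid , J-improving) ∣J∣≤∣P∣ J-closed W∩J-empty =
      size , valid-∪ J-valid (piece-valid Q-piece) no-edge , improving-∪⁺ {X = J} {Q} J∩Q-empty J-improving Q-deficit
      where
      Q⊆W = p─q⊆p W P
      J∩Q-empty : Empty (J ∩ Q)
      J∩Q-empty = Empty-∩-mono id Q⊆W (subst Empty (∩-comm W J) W∩J-empty)
      no-edge : ∀ {a b} → a ∈ J → b ∈ Q → ¬ Edge G a b
      no-edge a∈J b∈Q e = W∩J-empty (_ , x∈p∩q⁺ (Q⊆W b∈Q , J-closed a∈J (Q⊆W b∈Q) e))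
      size : ∣ J ∪ Q ∣ ≤ k
      size = begin
        ∣ J ∪ Q ∣     ≡⟨ ∣p∪q∣≡∣p∣+∣q∣ J Q J∩Q-empty ⟩
        ∣ J ∣ + ∣ Q ∣ ≤⟨ +-monoˡ-≤ ∣ Q ∣ ∣J∣≤∣P∣ ⟩
        ∣ P ∣ + ∣ Q ∣ ≤⟨ ∣P∣+∣Q∣≤k ⟩
        k             ∎
        where open ≤-Reasoning

    meets : ∀ {J} → fam j ≡ just J → MinConnSwap G S (k ∸ d + j) j J →
            ∃[ W′ ] (GoodSwap G S k d W′ × MeetsFamily d fam W′)
    meets {J} fam-j≡J ((J-good , _) , J-min) with meetsN? G W J
    ... | yes W-meets-N[J] = W , W-good , j , J , 1≤j , 2*j≤d , fam-j≡J , inj₂ W-meets-N[J]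
    ... | no  ¬meets with (W ∩ J) ⊂? J
    ...   | no  W∩J⊄J = W , W-good , j , J , 1≤j , 2*j≤d , fam-j≡J ,
                        inj₁ (proj₁ ∘ x∈p∩q⁻ W J ∘ ⊆∧⊄⇒⊇ (p∩q⊆q W J) W∩J⊄J)
    ...   | yes W∩J⊂J with nonempty? (W ∩ J)
    ...     | yes W∩J-nonempty = ⊥-elim (<⇒≱ (p⊂q⇒∣p∣<∣q∣ W∩J⊂J) (≤-trans (J-min C C-swap)
                (∣C∣≤closed (p∩q⊆p W J) W∩J-nonempty (∩-closed G (¬meetsN⇒closed G ¬meets)))))
    ...     | no  W∩J-empty = J ∪ Q , J∪Q-good J-good (J-min P P-swap) (¬meetsN⇒closed G ¬meets) W∩J-empty ,
                              j , J , 1≤j , 2*j≤d , fam-j≡J , inj₁ (p⊆p∪q Q)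

    result : ∃[ W′ ] (GoodSwap G S k d W′ × MeetsFamily d fam W′)
    result with fam j in fam-j≡ | family j 1≤j j≤d
    ... | nothing | ∄swap = ⊥-elim (∄swap (P , P-swap))
    ... | just J  | J-min = meets fam-j≡ J-min

proposition22 : ∀ {n} (G : Graph n) (S : Subset n) (k d : ℕ)
    → YesInstance G S k d
    → (fam : ℕ → Maybe (Subset n))
    → IsSwapFamily G S k d fam
    → ∃[ W ] (GoodSwap G S k d W
        × (Connected G W
           ⊎ ∃[ j ] ∃[ Wj ] (1 ≤ j × 2 * j ≤ d × fam j ≡ just Wj
               × (Wj ⊆ W ⊎ ∃[ v ] (v ∈ W × _∈N[_] G v Wj)))))
proposition22 G S k d (S-cover , _ , d≤k , good) fam family
  with argmin (goodSwap? G S k d) ∣_∣ good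
... | W , W-good , W-min with connected-or-piece G W
...   | inj₁ W-connected = W , W-good , inj₁ W-connected
...   | inj₂ piece =
  let (P , P-piece , P-min) = argmin (piece? G W) (agreement G S) piece
      (C , C-piece , C-min) = argmin (piece? G W) ∣_∣ piece
      (W′ , W′-good , W′-meets) =
        Disconnected.result G S S-cover d≤k fam family W-good W-min P-piece P-min C-piece C-min
  in W′ , W′-good , inj₂ W′-meets
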